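{- For integers $n,t$ define the polynomial in $x$ $$\begin{aligned}\psi^{(n,t)}(x)=&(n+1)(n-x)^2(n-x+1)^2(2n-2t+2x+1)(2n-2t+2x-1)\\&+(n+1)(n-t+x)^2(n-t+x+1)^2(2n-2x-1)(2n-2x+1)\\&-2n(n-x+1)^2(n-t+x+1)^2(2n-2x-1)(2n-2t+2x-1).\end{aligned}$$ Given integers $n\geq 2$ and $0\leq t\leq n-1$, there exists $k'$ (depending on $n,t$) such that $\psi^{(n,t)}(k)\geq 0$ for integers $1\leq k\leq k'$ and $\psi^{(n,t)}(k)\leq 0$ for integers $k'<k\leq t/2$. -}

module Defs where

open import Data.Integer using (ℤ; _+_; _-_; _*_; +_)

private
  sq : ℤ → ℤ
  sq a = a * a

ψ : ℤ → ℤ → ℤ → ℤ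
ψ n t x =
    ((n + + 1) * sq (n - x) * sq (n - x + + 1)
       * (+ 2 * n - + 2 * t + + 2 * x + + 1) * (+ 2 * n - + 2 * t + + 2 * x - + 1))
  + ((n + + 1) * sq (n - t + x) * sq (n - t + x + + 1)
       * (+ 2 * n - + 2 * x - + 1) * (+ 2 * n - + 2 * x + + 1))
  - (+ 2 * n * sq (n - x + + 1) * sq (n - t + x + + 1)
       * (+ 2 * n - + 2 * x - + 1) * (+ 2 * n - + 2 * t + + 2 * x - + 1))

module Submission where

-- Put a = n − x and b = n − t + x. Then ψ n t x = Ψ n a b := (n + 1) N(a, b) − 2n D(a, b),
-- which is D(a, b) ((n + 1) N/D − 2n), and x ↦ x + 1 is the step (a, b) ↦ (a − 1, b + 1).
-- For 1 ≤ b < a the denominator D is positive and the cross difference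
-- D(a − 1, b + 1) N(a, b) − D(a, b) N(a − 1, b + 1) is (a − b − 1) times a polynomial in
-- a − b − 1 and b − 1 with positive coefficients, so N/D does not increase along the step.
-- Hence ψ(k) ≤ 0 with 2k < t forces ψ(k + 1) ≤ 0: on 1 ≤ k ≤ t/2 the sign of ψ changes at
-- most once, from ≥ 0 to ≤ 0.

open import Algebra.Bundles.Raw using (RawRing)
open import Data.List.Base using (List; []; _∷_)
open import Data.Nat.Base as ℕ using (ℕ; suc; z≤n; s≤s; z<s; ⌊_/2⌋; ⌈_/2⌉)

-- The polynomials of the argument, over an arbitrary raw ring: at ℤ they are the functions
-- reasoned about, at the ring solver's syntax they are what the solver normalises.
module Forms {c ℓ} (R : RawRing c ℓ) where
  open RawRing R

  infixl 6 _-_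
  _-_ : Carrier → Carrier → Carrier
  u - v = u + - v

  2# : Carrier
  2# = 1# + 1#

  sq : Carrier → Carrier
  sq u = u * u

  -- a * 2# rather than 2# * a, so that over ℤ D computes to a successor at positive a and b.
  D : Carrier → Carrier → Carrier
  D a b = sq (a + 1#) * sq (b + 1#) * (a * 2# - 1#) * (b * 2# - 1#)

  N : Carrier → Carrier → Carrier
  N a b = sq a * sq (a + 1#) * (b * 2# + 1#) * (b * 2# - 1#)
        + sq b * sq (b + 1#) * (a * 2# - 1#) * (a * 2# + 1#)

  Ψ : Carrier → Carrier → Carrier → Carrier
  Ψ n a b = (n + 1#) * N a b - 2# * n * D a b

  cross : Carrier → Carrier → Carrier
  cross a b = D (a - 1#) (b + 1#) * N a b - D a b * N (a - 1#) (b + 1#)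

  ψ-form : Carrier → Carrier → Carrier → Carrier
  ψ-form n t x =
      ((n + 1#) * sq (n - x) * sq (n - x + 1#)
         * (2# * n - 2# * t + 2# * x + 1#) * (2# * n - 2# * t + 2# * x - 1#))
    + ((n + 1#) * sq (n - t + x) * sq (n - t + x + 1#)
         * (2# * n - 2# * x - 1#) * (2# * n - 2# * x + 1#))
    - (2# * n * sq (n - x + 1#) * sq (n - t + x + 1#)
         * (2# * n - 2# * x - 1#) * (2# * n - 2# * t + 2# * x - 1#))

module Horner {c ℓ} (R : RawRing c ℓ) (fromℕ : ℕ → RawRing.Carrier R) where
  open RawRing R

  horner : List ℕ → Carrier → Carrier
  horner []       y = 0#
  horner (c ∷ cs) y = fromℕ c + y * horner cs y

  horner₂ : List (List ℕ) → Carrier → Carrier → Carrier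
  horner₂ []         x y = 0#
  horner₂ (cs ∷ css) x y = horner cs y + x * horner₂ css x y

open import Defs
open import Data.Integer using (ℤ; _+_; _-_; _*_; +_; _≤_; _<_)
open import Data.Product using (∃-syntax; _×_; _,_)
open import Data.Integer.Base using (+≤+; +<+; -[1+_]; 0ℤ; 1ℤ; +-*-rawRing; positive; nonNegative)
open import Data.Integer.Properties
  using (≤-refl; ≤-trans; <⇒≤; _≤?_; ≰⇒>; +-mono-≤; +-monoʳ-≤; *-zeroʳ; pos-*; drop‿+≤+;
         i≤j⇒0≤j-i; 0≤i-j⇒j≤i; i<j⇒suc[i]≤j; suc[i]≤j⇒i<j;
         *-monoˡ-≤-nonNeg; *-cancelˡ-≤-pos; module ≤-Reasoning)
open import Data.Integer.Solver using (module +-*-Solver)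
open +-*-Solver using (Polynomial; con; _:+_; :-_; _:*_; _:-_; _:=_)
open import Data.Integer.Tactic.RingSolver using (solve-∀; solve)
import Data.Nat.Properties as ℕ
open import Data.Sum using (inj₁; inj₂)
open import Function using (_∘_)
open import Relation.Binary.PropositionalEquality
open import Relation.Nullary using (yes; no; contradiction)

polynomialRawRing : ℕ → RawRing _ _
polynomialRawRing m = record
  { Carrier = Polynomial m
  ; _≈_ = _≡_
  ; _+_ = _:+_
  ; _*_ = _:*_
  ; -_ = :-_
  ; 0# = con 0ℤ
  ; 1# = con 1ℤ
  }

open Forms +-*-rawRing using (D; N; Ψ; cross)
open Horner +-*-rawRing +_ using (horner; horner₂)

module Syntax {m : ℕ} where
  open Forms (polynomialRawRing m) public
  open Horner (polynomialRawRing m) (λ c → con (+ c)) public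

ψ≡Ψ : ∀ n t x → ψ n t x ≡ Ψ n (n - x) (n - t + x)
ψ≡Ψ = +-*-Solver.solve 3
  (λ n t x → Syntax.ψ-form n t x := Syntax.Ψ n (n :- x) (n :- t :+ x)) refl

-- Row i holds the coefficients of eⁱ β⁰, eⁱ β¹, … of cross (β + e + 2) (β + 1) / e, read off its
-- expansion; the division is exact because N and D are symmetric, so cross vanishes at e = 0.
cross-cofactor : List (List ℕ)
cross-cofactor =
  ( (6048 ∷ 39024 ∷ 119064 ∷ 217604 ∷ 257224 ∷ 203036 ∷ 107952 ∷ 38176 ∷ 8608 ∷ 1120 ∷ 64 ∷ [])
  ∷ (19512 ∷ 119064 ∷ 326406 ∷ 514448 ∷ 507590 ∷ 323856 ∷ 133616 ∷ 34432 ∷ 5040 ∷ 320 ∷ [])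
  ∷ (24792 ∷ 139636 ∷ 336436 ∷ 448512 ∷ 361172 ∷ 180128 ∷ 54464 ∷ 9152 ∷ 656 ∷ [])
  ∷ (15417 ∷ 79212 ∷ 165178 ∷ 182584 ∷ 116280 ∷ 42880 ∷ 8512 ∷ 704 ∷ [])
  ∷ (4848 ∷ 22678 ∷ 40418 ∷ 36080 ∷ 17252 ∷ 4224 ∷ 416 ∷ [])
  ∷ (729 ∷ 3102 ∷ 4648 ∷ 3208 ∷ 1040 ∷ 128 ∷ [])
  ∷ (42 ∷ 160 ∷ 196 ∷ 96 ∷ 16 ∷ [])
  ∷ [] )

cross-expansion : ∀ β e → cross (β + e + + 2) (β + + 1) ≡ e * horner₂ cross-cofactor e β
cross-expansion = +-*-Solver.solve 2
  (λ β e → Syntax.cross (β :+ e :+ con (+ 2)) (β :+ con (+ 1))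
        := e :* Syntax.horner₂ cross-cofactor e β)
  refl

0≤i⇒0≤j⇒0≤i*j : ∀ {i j} → + 0 ≤ i → + 0 ≤ j → + 0 ≤ i * j
0≤i⇒0≤j⇒0≤i*j {+ m} {+ n} _ _ = subst (+ 0 ≤_) (pos-* m n) (+≤+ z≤n)

horner-nonNeg : ∀ cs {y} → + 0 ≤ y → + 0 ≤ horner cs y
horner-nonNeg []       0≤y = ≤-refl
horner-nonNeg (c ∷ cs) 0≤y = +-mono-≤ (+≤+ z≤n) (0≤i⇒0≤j⇒0≤i*j 0≤y (horner-nonNeg cs 0≤y))

horner₂-nonNeg : ∀ css {x y} → + 0 ≤ x → + 0 ≤ y → + 0 ≤ horner₂ css x y
horner₂-nonNeg []         0≤x 0≤y = ≤-refl
horner₂-nonNeg (cs ∷ css) 0≤x 0≤y =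
  +-mono-≤ (horner-nonNeg cs 0≤y) (0≤i⇒0≤j⇒0≤i*j 0≤x (horner₂-nonNeg css 0≤x 0≤y))

D-pos : ∀ {a b} → + 1 ≤ a → + 1 ≤ b → + 0 < D a b
D-pos (+≤+ (s≤s _)) (+≤+ (s≤s _)) = +<+ z<s

cross-nonNeg : ∀ {a b} → + 1 ≤ b → b < a → + 0 ≤ cross a b
cross-nonNeg {a} {b} 1≤b b<a =
  subst (+ 0 ≤_) (sym cross≡) (0≤i⇒0≤j⇒0≤i*j 0≤e (horner₂-nonNeg cross-cofactor 0≤e 0≤β))
  where
  β e : ℤ
  β = b - + 1
  e = a - (+ 1 + b)
  0≤β : + 0 ≤ β
  0≤β = i≤j⇒0≤j-i 1≤b
  0≤e : + 0 ≤ e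
  0≤e = i≤j⇒0≤j-i (i<j⇒suc[i]≤j b<a)
  a≡ : a ≡ (b - + 1) + (a - (+ 1 + b)) + + 2
  a≡ = solve (a ∷ b ∷ [])
  b≡ : b ≡ (b - + 1) + + 1
  b≡ = solve (b ∷ [])
  cross≡ : cross a b ≡ e * horner₂ cross-cofactor e β
  cross≡ = begin
    cross a b                           ≡⟨ cong₂ cross a≡ b≡ ⟩
    cross (β + e + + 2) (β + + 1)       ≡⟨ cross-expansion β e ⟩
    e * horner₂ cross-cofactor e β      ∎
    where open ≡-Reasoning

Ψ-cross : ∀ n a b a′ b′ →
  D a′ b′ * Ψ n a b - D a b * Ψ n a′ b′ ≡ (n + + 1) * (D a′ b′ * N a b - D a b * N a′ b′)
Ψ-cross n a b a′ b′ = cancel-2nD n (D a b) (D a′ b′) (N a b) (N a′ b′)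
  where
  cancel-2nD : ∀ n d d′ m m′ →
    d′ * ((n + + 1) * m - + 2 * n * d) - d * ((n + + 1) * m′ - + 2 * n * d′)
      ≡ (n + + 1) * (d′ * m - d * m′)
  cancel-2nD = solve-∀

Ψ-nonpos-step : ∀ n {a b} → + 0 ≤ n + + 1 → + 1 ≤ b → b < a →
  Ψ n a b ≤ + 0 → Ψ n (a - + 1) (b + + 1) ≤ + 0
Ψ-nonpos-step n {a} {b} 0≤n+1 1≤b@(+≤+ (s≤s _)) b<a@(+<+ (s≤s (s≤s _))) Ψ≤0 =
  *-cancelˡ-≤-pos (Ψ n a′ b′) (+ 0) (D a b) ⦃ positive 0<D ⦄ (begin
    D a b * Ψ n a′ b′    ≤⟨ 0≤i-j⇒j≤i (subst (+ 0 ≤_) (sym (Ψ-cross n a b a′ b′))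
                              (0≤i⇒0≤j⇒0≤i*j 0≤n+1 (cross-nonNeg 1≤b b<a))) ⟩
    D a′ b′ * Ψ n a b    ≤⟨ *-monoˡ-≤-nonNeg (D a′ b′) ⦃ nonNegative (<⇒≤ 0<D′) ⦄ Ψ≤0 ⟩
    D a′ b′ * + 0        ≡⟨ *-zeroʳ (D a′ b′) ⟩
    + 0                  ≡⟨ *-zeroʳ (D a b) ⟨
    D a b * + 0          ∎)
  where
  open ≤-Reasoning
  a′ b′ : ℤ
  a′ = a - + 1
  b′ = b + + 1
  0<D : + 0 < D a b
  0<D = D-pos {a} {b} (≤-trans 1≤b (<⇒≤ b<a)) 1≤b
  -- The patterns above make a = 2 + α and b = 1 + β, so 1 ≤ a′ and 1 ≤ b′ hold by computation.
  0<D′ : + 0 < D a′ b′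
  0<D′ = D-pos {a′} {b′} (+≤+ (s≤s z≤n)) (+≤+ (s≤s z≤n))

ψ-nonpos-step : ∀ n t x → + 0 ≤ n + + 1 → + 1 ≤ n - t + x → + 2 * x < t →
  ψ n t x ≤ + 0 → ψ n t (+ 1 + x) ≤ + 0
ψ-nonpos-step n t x 0≤n+1 1≤b 2x<t ψ≤0 =
  subst (_≤ + 0) (sym ψ[1+x]≡Ψ)
    (Ψ-nonpos-step n 0≤n+1 1≤b b<a (subst (_≤ + 0) (ψ≡Ψ n t x) ψ≤0))
  where
  gap : t - (+ 1 + + 2 * x) ≡ (n - x) - (+ 1 + (n - t + x))
  gap = solve (n ∷ t ∷ x ∷ [])
  b<a : n - t + x < n - x
  b<a = suc[i]≤j⇒i<j (0≤i-j⇒j≤i (subst (+ 0 ≤_) gap (i≤j⇒0≤j-i (i<j⇒suc[i]≤j 2x<t))))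
  a≡ : n - (+ 1 + x) ≡ n - x - + 1
  a≡ = solve (n ∷ x ∷ [])
  b≡ : n - t + (+ 1 + x) ≡ n - t + x + + 1
  b≡ = solve (n ∷ t ∷ x ∷ [])
  ψ[1+x]≡Ψ : ψ n t (+ 1 + x) ≡ Ψ n (n - x - + 1) (n - t + x + + 1)
  ψ[1+x]≡Ψ = trans (ψ≡Ψ n t (+ 1 + x)) (cong₂ (Ψ n) a≡ b≡)

t≤n-1⇒1≤n-t+x : ∀ {n t x} → t ≤ n - + 1 → + 0 ≤ x → + 1 ≤ n - t + x
t≤n-1⇒1≤n-t+x {n} {t} {x} t≤n-1 0≤x =
  subst (+ 1 ≤_) b≡ (+-monoʳ-≤ (+ 1) (+-mono-≤ (i≤j⇒0≤j-i t≤n-1) 0≤x))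
  where
  b≡ : + 1 + ((n - + 1 - t) + x) ≡ n - t + x
  b≡ = solve (n ∷ t ∷ x ∷ [])

sign-threshold : (f : ℕ → ℤ) (m : ℕ) →
  (∀ {k} → 1 ℕ.≤ k → k ℕ.< m → f k ≤ + 0 → f (suc k) ≤ + 0) →
  ∃[ k′ ] k′ ℕ.≤ m × (∀ {k} → 1 ℕ.≤ k → k ℕ.≤ k′ → + 0 ≤ f k)
                   × (∀ {k} → k′ ℕ.< k → k ℕ.≤ m → f k ≤ + 0)
sign-threshold f ℕ.zero step = 0 , z≤n , (λ { (s≤s _) () }) , (λ { (s≤s _) () })
sign-threshold f (suc m) step with sign-threshold f m (λ 1≤k k<m → step 1≤k (ℕ.m<n⇒m<1+n k<m))
... | k′ , k′≤m , nonneg , nonpos with ℕ.m≤n⇒m<n∨m≡n k′≤m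
...   | inj₁ k′<m = k′ , ℕ.m≤n⇒m≤1+n k′≤m , nonneg , nonpos′
  where
  nonpos′ : ∀ {k} → k′ ℕ.< k → k ℕ.≤ suc m → f k ≤ + 0
  nonpos′ k′<k k≤1+m with ℕ.m≤n⇒m<n∨m≡n k≤1+m
  ... | inj₁ k<1+m = nonpos k′<k (ℕ.m<1+n⇒m≤n k<1+m)
  ... | inj₂ refl  = step (ℕ.≤-trans (s≤s z≤n) k′<m) ℕ.≤-refl (nonpos k′<m ℕ.≤-refl)
...   | inj₂ refl with + 0 ≤? f (suc k′)
...     | yes 0≤f =
  suc k′ , ℕ.≤-refl , nonneg′ , λ 1+k′<k k≤1+k′ → contradiction k≤1+k′ (ℕ.<⇒≱ 1+k′<k)
  where
  nonneg′ : ∀ {k} → 1 ℕ.≤ k → k ℕ.≤ suc k′ → + 0 ≤ f k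
  nonneg′ 1≤k k≤1+k′ with ℕ.m≤n⇒m<n∨m≡n k≤1+k′
  ... | inj₁ k<1+k′ = nonneg 1≤k (ℕ.m<1+n⇒m≤n k<1+k′)
  ... | inj₂ refl   = 0≤f
...     | no 0≰f = k′ , ℕ.n≤1+n k′ , nonneg , nonpos′
  where
  nonpos′ : ∀ {k} → k′ ℕ.< k → k ℕ.≤ suc k′ → f k ≤ + 0
  nonpos′ k′<k k≤1+k′ rewrite ℕ.≤-antisym k≤1+k′ k′<k = <⇒≤ (≰⇒> 0≰f)

2*⌊n/2⌋≤n : ∀ n → 2 ℕ.* ⌊ n /2⌋ ℕ.≤ n
2*⌊n/2⌋≤n n = begin
  2 ℕ.* ⌊ n /2⌋         ≡⟨ cong (⌊ n /2⌋ ℕ.+_) (ℕ.+-identityʳ ⌊ n /2⌋) ⟩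
  ⌊ n /2⌋ ℕ.+ ⌊ n /2⌋   ≤⟨ ℕ.+-monoʳ-≤ ⌊ n /2⌋ (ℕ.⌊n/2⌋≤⌈n/2⌉ n) ⟩
  ⌊ n /2⌋ ℕ.+ ⌈ n /2⌉   ≡⟨ ℕ.⌊n/2⌋+⌈n/2⌉≡n n ⟩
  n                     ∎
  where open ℕ.≤-Reasoning

2*m≤n⇒m≤⌊n/2⌋ : ∀ {m n} → 2 ℕ.* m ℕ.≤ n → m ℕ.≤ ⌊ n /2⌋
2*m≤n⇒m≤⌊n/2⌋ {m} {n} 2m≤n = begin
  m                     ≡⟨ ℕ.n≡⌊n+n/2⌋ m ⟩
  ⌊ m ℕ.+ m /2⌋         ≡⟨ cong (λ k → ⌊ m ℕ.+ k /2⌋) (ℕ.+-identityʳ m) ⟨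
  ⌊ 2 ℕ.* m /2⌋         ≤⟨ ℕ.⌊n/2⌋-mono 2m≤n ⟩
  ⌊ n /2⌋               ∎
  where open ℕ.≤-Reasoning

proposition3p5 : (n t : ℤ) → + 2 ≤ n → + 0 ≤ t → t ≤ n - + 1 →
    ∃[ k′ ] (((k : ℤ) → + 1 ≤ k → k ≤ k′ → + 0 ≤ ψ n t k)
           × ((k : ℤ) → k′ < k → + 2 * k ≤ t → ψ n t k ≤ + 0))
proposition3p5 n -[1+ _ ] _ () _
proposition3p5 n (+ s) 2≤n _ t≤n-1 =
  let k′ , _ , nonneg , nonpos = sign-threshold (ψ n (+ s) ∘ +_) ⌊ s /2⌋ step in
  + k′ ,
  (λ { (+ j) (+≤+ 1≤j) (+≤+ j≤k′) → nonneg 1≤j j≤k′ }) ,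
  (λ { (+ j) (+<+ k′<j) 2j≤s →
         nonpos k′<j (2*m≤n⇒m≤⌊n/2⌋ (drop‿+≤+ (subst (_≤ + s) (sym (pos-* 2 j)) 2j≤s))) })
  where
  0≤n+1 : + 0 ≤ n + + 1
  0≤n+1 = +-mono-≤ (≤-trans (+≤+ z≤n) 2≤n) (+≤+ z≤n)
  step : ∀ {j} → 1 ℕ.≤ j → j ℕ.< ⌊ s /2⌋ → ψ n (+ s) (+ j) ≤ + 0 → ψ n (+ s) (+ suc j) ≤ + 0
  step {j} _ j<s/2 = ψ-nonpos-step n (+ s) (+ j) 0≤n+1 (t≤n-1⇒1≤n-t+x {n} t≤n-1 (+≤+ z≤n))
    (subst (_< + s) (pos-* 2 j) (+<+ (ℕ.<-≤-trans (ℕ.*-monoʳ-< 2 j<s/2) (2*⌊n/2⌋≤n s))))
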